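{- Let $\langle\phi,\vec a\rangle$ be a loop. If \[ \langle\!\langle\top\mid\top\mid\phi\rangle\!\rangle_{\vec a}\leadsto_{\mathit{nt}}^*\langle\!\langle\psi\mid\check\phi\mid\top\rangle\!\rangle_{\vec a} \] and $\psi$ is satisfiable, then $\psi$ is a certificate of non-termination for $\langle\phi,\vec a\rangle$.
   Context: Fix $d\ge 1$ and integer variables $\vec x=(x_1,\dots,x_d)$. A loop $\langle\phi,\vec a\rangle$ consists of a quantifier-free formula $\phi$ over atoms $p>0$ ($p$ an arithmetic expression over $\vec x$, integer semantics) and a map $\vec a:\mathbb Z^d\to\mathbb Z^d$ given by expressions over $\vec x$; $\vec a^m$ is $m$-fold application ($\vec a^0=\mathrm{id}$); $\top$ denotes truth. A vector $\vec x\in\mathbb Z^d$ is a witness of non-termination for $\langle\phi,\vec a\rangle$ if $\phi(\vec a^m(\vec x))$ holds for all $m\in\mathbb N$. A quantifier-free formula $\eta$ over $\vec x$ is a certificate of non-termination for the loop if $\eta$ is satisfiable and every $\vec x\in\mathbb Z^d$ with $\eta(\vec x)$ is a witness of non-termination. A conditional non-termination technique is a partial function $\mathit{nt}$ mapping pairs (loop $\langle\chi,\vec a\rangle$, quantifier-free formula $\check\phi$ over $\vec x$) to quantifier-free formulas over $\vec x$ such that for all $(\langle\chi,\vec a\rangle,\check\phi)$ in its domain and all $\vec x\in\mathbb Z^d$: if $\vec x$ is a witness of non-termination for $\langle\check\phi,\vec a\rangle$ and $\mathit{nt}(\langle\chi,\vec a\rangle,\check\phi)(\vec x)$ holds, then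 $\vec x$ is a witness of non-termination for $\langle\chi,\vec a\rangle$. Formulas are in CNF and identified with their sets of clauses. A non-termination problem is a tuple $\langle\!\langle\psi\mid\check\phi\mid\hat\phi\rangle\!\rangle_{\vec a}$ with $\psi,\check\phi,\hat\phi$ quantifier-free formulas over $\vec x$ and $\vec a:\mathbb Z^d\to\mathbb Z^d$. The relation $\leadsto_{\mathit{nt}}$ is defined by: $\langle\!\langle\psi_1\mid\check\phi\mid\hat\phi\rangle\!\rangle_{\vec a}\leadsto_{\mathit{nt}}\langle\!\langle\psi_1\cup\psi_2\mid\check\phi\cup\chi\mid\hat\phi\setminus\chi\rangle\!\rangle_{\vec a}$ whenever $\emptyset\ne\chi\subseteq\hat\phi$ (as sets of clauses) and $\mathit{nt}(\langle\chi,\vec a\rangle,\check\phi)=\psi_2$ for some conditional non-termination technique $\mathit{nt}$; $\leadsto_{\mathit{nt}}^*$ is its reflexive-transitive closure. -}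

module Defs where

open import Data.Nat using (ℕ; zero; suc)
open import Data.Integer using (ℤ; _+_; _*_; -_; _>_; +_)
open import Data.Fin using (Fin)
open import Data.Vec using (Vec; lookup; map)
open import Data.List using (List; []; _++_)
open import Data.List.Relation.Unary.All using (All)
open import Data.List.Relation.Unary.Any using (Any)
open import Data.List.Membership.Propositional using (_∈_; _∉_)
open import Data.Maybe using (Maybe; just)
open import Data.Product using (_×_; ∃; Σ)
open import Relation.Nullary using (¬_)
open import Relation.Binary.PropositionalEquality using (_≡_)
open import Function.Bundles using (_⇔_)

data Expr (d : ℕ) : Set where
  const : ℤ → Expr d
  var   : Fin d → Expr d
  _⊕_   : Expr d → Expr d → Expr d
  _⊗_   : Expr d → Expr d → Expr d
  neg   : Expr d → Expr d

⟦_⟧ₑ : ∀ {d} → Expr d → Vec ℤ d → ℤ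
⟦ const c ⟧ₑ x = c
⟦ var i ⟧ₑ x = lookup x i
⟦ p ⊕ q ⟧ₑ x = ⟦ p ⟧ₑ x + ⟦ q ⟧ₑ x
⟦ p ⊗ q ⟧ₑ x = ⟦ p ⟧ₑ x * ⟦ q ⟧ₑ x
⟦ neg p ⟧ₑ x = - ⟦ p ⟧ₑ x

data Literal (d : ℕ) : Set where
  pos : Expr d → Literal d
  ngt : Expr d → Literal d

⟦_⟧ₗ : ∀ {d} → Literal d → Vec ℤ d → Set
⟦ pos p ⟧ₗ x = ⟦ p ⟧ₑ x > + 0
⟦ ngt p ⟧ₗ x = ¬ (⟦ p ⟧ₑ x > + 0)

Clause : ℕ → Set
Clause d = List (Literal d)

Formula : ℕ → Set
Formula d = List (Clause d)

⟦_⟧c : ∀ {d} → Clause d → Vec ℤ d → Set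
⟦ c ⟧c x = Any (λ l → ⟦ l ⟧ₗ x) c

⟦_⟧f : ∀ {d} → Formula d → Vec ℤ d → Set
⟦ φ ⟧f x = All (λ c → ⟦ c ⟧c x) φ

⊤f : ∀ {d} → Formula d
⊤f = []

Update : ℕ → Set
Update d = Vec (Expr d) d

⟦_⟧u : ∀ {d} → Update d → Vec ℤ d → Vec ℤ d
⟦ a ⟧u x = map (λ e → ⟦ e ⟧ₑ x) a

iter : ∀ {d} → Update d → ℕ → Vec ℤ d → Vec ℤ d
iter a zero x = x
iter a (suc m) x = ⟦ a ⟧u (iter a m x)

record Loop (d : ℕ) : Set where
  constructor ⟨_,_⟩
  field
    guard  : Formula d
    update : Update d

Satisfiable : ∀ {d} → Formula d → Set
Satisfiable {d} η = ∃ λ (x : Vec ℤ d) → ⟦ η ⟧f x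

WitnessNT : ∀ {d} → Loop d → Vec ℤ d → Set
WitnessNT ⟨ φ , a ⟩ x = ∀ (m : ℕ) → ⟦ φ ⟧f (iter a m x)

CertificateNT : ∀ {d} → Loop d → Formula d → Set
CertificateNT L η = Satisfiable η × (∀ x → ⟦ η ⟧f x → WitnessNT L x)

NTFun : ℕ → Set
NTFun d = Loop d → Formula d → Maybe (Formula d)

IsCondNTTechnique : ∀ {d} → NTFun d → Set
IsCondNTTechnique {d} nt =
  ∀ (χ : Formula d) (a : Update d) (φ̌ ψ : Formula d) →
  nt ⟨ χ , a ⟩ φ̌ ≡ just ψ →
  ∀ (x : Vec ℤ d) → WitnessNT ⟨ φ̌ , a ⟩ x → ⟦ ψ ⟧f x → WitnessNT ⟨ χ , a ⟩ x

record Problem (d : ℕ) : Set where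
  constructor ⟪_∣_∣_⟫_
  field
    ψ  : Formula d
    φ̌ : Formula d
    φ̂ : Formula d
    ā  : Update d

-- ⟪ψ₁∣φ̌∣φ̂⟫ ↝ ⟪ψ₁ ∪ ψ₂ ∣ φ̌ ∪ χ ∣ φ̂ \ χ⟫, with sets of clauses represented by lists;
-- union is _++_, and φ̂ \ χ is any list whose members are exactly the members of φ̂ not in χ.
data _↝_ {d : ℕ} : Problem d → Problem d → Set₁ where
  step : ∀ {ψ₁ φ̌ φ̂ rest : Formula d} {a : Update d} (χ ψ₂ : Formula d) →
         (∃ λ c → c ∈ χ) →
         (∀ {c} → c ∈ χ → c ∈ φ̂) →
         (∀ c → (c ∈ rest) ⇔ (c ∈ φ̂ × c ∉ χ)) →
         (Σ (NTFun d) λ nt → IsCondNTTechnique nt × nt ⟨ χ , a ⟩ φ̌ ≡ just ψ₂) →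
         (⟪ ψ₁ ∣ φ̌ ∣ φ̂ ⟫ a) ↝ (⟪ ψ₁ ++ ψ₂ ∣ φ̌ ++ χ ∣ rest ⟫ a)

{-# OPTIONS --safe #-}
module Submission where

-- The derivation maintains two invariants for ⟪ ψ ∣ φ̌ ∣ φ̂ ⟫: every model of ψ witnesses
-- non-termination of ⟨ φ̌ , ā ⟩, and φ̌ ∧ φ̂ entails φ. A step moves χ from φ̂ to φ̌; the
-- first invariant survives because the technique lifts witnesses for φ̌ to witnesses for χ
-- on models of ψ₂, the second because clause truth is decidable, so a clause of φ̂ false at
-- some point cannot lie in χ and hence lies in φ̂ \ χ. At the end φ̂ = ⊤, so φ̌ entails φ.

open import Defs
open import Relation.Binary.Construct.Closure.ReflexiveTransitive using (Star; ε; _◅_)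
open import Data.Nat using (ℕ)
open import Data.List using ([]; _++_)
open import Data.List.Relation.Unary.All as All using ([])
open import Data.List.Relation.Unary.All.Properties using (++⁺; ++⁻ˡ; ++⁻ʳ)
open import Data.List.Relation.Unary.Any using (any?)
open import Data.List.Membership.Propositional using (_∈_; _∉_)
open import Data.Product using (_×_; _,_; proj₁; proj₂)
open import Data.Vec using (Vec)
open import Data.Integer using (ℤ; +_)
open import Data.Integer.Properties using (_<?_)
open import Relation.Nullary using (Dec; yes; no; ¬?; contradiction)
open import Function.Bundles using (_⇔_; Equivalence)

private
  variable
    d : ℕ

⟦_⟧ₗ? : (l : Literal d) (x : Vec ℤ d) → Dec (⟦ l ⟧ₗ x)
⟦ pos p ⟧ₗ? x = + 0 <? ⟦ p ⟧ₑ x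
⟦ ngt p ⟧ₗ? x = ¬? (+ 0 <? ⟦ p ⟧ₑ x)

⟦_⟧c? : (c : Clause d) (x : Vec ℤ d) → Dec (⟦ c ⟧c x)
⟦ c ⟧c? x = any? (λ l → ⟦ l ⟧ₗ? x) c

infix 4 _⊨_

_⊨_ : Formula d → Formula d → Set
_⊨_ {d} η φ = ∀ (x : Vec ℤ d) → ⟦ η ⟧f x → ⟦ φ ⟧f x

++-difference-⊨ : {χ φ̂ rest : Formula d} →
                  (∀ c → (c ∈ rest) ⇔ (c ∈ φ̂ × c ∉ χ)) → χ ++ rest ⊨ φ̂
++-difference-⊨ {χ = χ} {φ̂} {rest} rest≡φ̂∖χ x χ∧rest = All.tabulate holds
  where
  holds : ∀ {c} → c ∈ φ̂ → ⟦ c ⟧c x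
  holds {c} c∈φ̂ with ⟦ c ⟧c? x
  ... | yes c-holds = c-holds
  ... | no c-fails = contradiction (All.lookup (++⁻ʳ χ χ∧rest) c∈rest) c-fails
    where
    c∈rest : c ∈ rest
    c∈rest = Equivalence.from (rest≡φ̂∖χ c)
               (c∈φ̂ , λ c∈χ → c-fails (All.lookup (++⁻ˡ χ χ∧rest) c∈χ))

witness-++ : ∀ {φ₁ φ₂ : Formula d} {a : Update d} {x : Vec ℤ d} →
             WitnessNT ⟨ φ₁ , a ⟩ x → WitnessNT ⟨ φ₂ , a ⟩ x → WitnessNT ⟨ φ₁ ++ φ₂ , a ⟩ x
witness-++ w₁ w₂ m = ++⁺ (w₁ m) (w₂ m)

witness-⊨ : ∀ {η φ : Formula d} {a : Update d} {x : Vec ℤ d} →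
            η ⊨ φ → WitnessNT ⟨ η , a ⟩ x → WitnessNT ⟨ φ , a ⟩ x
witness-⊨ {a = a} {x} η⊨φ w m = η⊨φ (iter a m x) (w m)

Sound : Formula d → Problem d → Set
Sound {d} φ (⟪ ψ ∣ φ̌ ∣ φ̂ ⟫ a) =
  (∀ (x : Vec ℤ d) → ⟦ ψ ⟧f x → WitnessNT ⟨ φ̌ , a ⟩ x) × (φ̌ ++ φ̂ ⊨ φ)

↝-preserves-Sound : ∀ (φ : Formula d) {P Q : Problem d} → P ↝ Q → Sound φ P → Sound φ Q
↝-preserves-Sound φ {⟪ ψ₁ ∣ φ̌ ∣ φ̂ ⟫ a}
  (step {rest = rest} χ ψ₂ _ _ rest≡φ̂∖χ (nt , nt-sound , nt≡ψ₂)) (ψ₁-witness , φ̌φ̂⊨φ) =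
  ψ-witness , φ̌χrest⊨φ
  where
  ψ-witness : ∀ x → ⟦ ψ₁ ++ ψ₂ ⟧f x → WitnessNT ⟨ φ̌ ++ χ , a ⟩ x
  ψ-witness x ψ₁∧ψ₂ = witness-++ φ̌-witness
    (nt-sound χ a φ̌ ψ₂ nt≡ψ₂ x φ̌-witness (++⁻ʳ ψ₁ ψ₁∧ψ₂))
    where φ̌-witness = ψ₁-witness x (++⁻ˡ ψ₁ ψ₁∧ψ₂)

  φ̌χrest⊨φ : (φ̌ ++ χ) ++ rest ⊨ φ
  φ̌χrest⊨φ x h = φ̌φ̂⊨φ x (++⁺ (++⁻ˡ φ̌ φ̌∧χ)
    (++-difference-⊨ rest≡φ̂∖χ x (++⁺ (++⁻ʳ φ̌ φ̌∧χ) (++⁻ʳ (φ̌ ++ χ) h))))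
    where φ̌∧χ = ++⁻ˡ (φ̌ ++ χ) h

↝*-preserves-Sound : ∀ (φ : Formula d) {P Q : Problem d} →
                     Star _↝_ P Q → Sound φ P → Sound φ Q
↝*-preserves-Sound φ ε sound = sound
↝*-preserves-Sound φ (s ◅ ss) sound = ↝*-preserves-Sound φ ss (↝-preserves-Sound φ s sound)

theorem14 : ∀ {d} (φ : Formula d) (a : Update d) (ψ φ̌ : Formula d) →
    Star _↝_ (⟪ ⊤f ∣ ⊤f ∣ φ ⟫ a) (⟪ ψ ∣ φ̌ ∣ ⊤f ⟫ a) →
    Satisfiable ψ →
    CertificateNT ⟨ φ , a ⟩ ψ
theorem14 φ a ψ φ̌ derivation sat = sat , λ x ψ-holds →
  witness-⊨ (proj₂ final) (witness-++ (proj₁ final x ψ-holds) λ _ → [])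
  where
  initial : Sound φ (⟪ ⊤f ∣ ⊤f ∣ φ ⟫ a)
  initial = (λ _ _ _ → []) , (λ _ φ-holds → φ-holds)

  final : Sound φ (⟪ ψ ∣ φ̌ ∣ ⊤f ⟫ a)
  final = ↝*-preserves-Sound φ derivation initial
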